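{- Let $a,b,c\ge 3$ be integers, at least one of which is not divisible by $4$. Put $P=(a-2)(b-2)(c-2)$, let $\delta=0$ if $\gcd(a,b,c)$ is odd and $\delta=2$ if $\gcd(a,b,c)$ is even, and for $n\in\mathbb{N}$ set $l_n=2^{3-\delta}Pn$ and $$v_{a,b,c}=2^{ -\delta}\big((a-4)^2(b-2)(c-2)+(a-2)(b-4)^2(c-2)+(a-2)(b-2)(c-4)^2\big).$$ Let $V$ be the ternary quadratic space over $\mathbb{Q}$ with diagonal form $\langle a-2,b-2,c-2\rangle$. Then either $V_2=V\otimes\mathbb{Q}_2$ is isotropic, or $l_n+v_{a,b,c}$ has bounded divisibility at $2$, i.e. there is a constant $C$ (depending on $a,b,c$) with $\operatorname{ord}_2(l_n+v_{a,b,c})\le C$ for all $n\in\mathbb{N}$.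
   Context: $\operatorname{ord}_2$ denotes the $2$-adic valuation; a quadratic space is isotropic if it has a nonzero vector $w$ with $Q(w)=0$. $\mathbb{N}=\{0,1,2,\dots\}$. -}

module Defs where

open import Data.Nat using (ℕ; zero; suc; _+_; _*_; _∸_; _^_; _<_; _%_; _/_; ∣_-_∣; NonZero)
open import Data.Nat.Properties using (m^n≢0)
open import Data.Nat.Divisibility using (_∣_; _∣?_)
open import Data.Nat.GCD using (gcd)
open import Data.Bool using (if_then_else_)
open import Data.Product using (Σ; _×_; ∃; _,_)
open import Data.Sum using (_⊎_)
open import Relation.Nullary using (¬_)
open import Relation.Nullary.Decidable using (⌊_⌋)
open import Relation.Binary.PropositionalEquality using (_≡_; _≢_)

-- The ring ℤ₂ of 2-adic integers, as the inverse limit lim ℤ/2^k: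
-- a compatible system of residues x k ∈ {0,…,2^k - 1}.

_mod2^_ : ℕ → ℕ → ℕ
m mod2^ k = _%_ m (2 ^ k) {{m^n≢0 2 k}}

record ℤ₂ : Set where
  constructor mkℤ₂
  field
    res     : ℕ → ℕ
    bounded : ∀ k → res k < 2 ^ k
    compat  : ∀ k → res (suc k) mod2^ k ≡ res k
open ℤ₂ public

NonZero₂ : ℤ₂ → Set
NonZero₂ x = ∃ λ k → res x k ≢ 0

diagFormRes : ℕ → ℕ → ℕ → ℤ₂ → ℤ₂ → ℤ₂ → ℕ → ℕ
diagFormRes A B C x y z k =
  (A * (res x k * res x k) + B * (res y k * res y k) + C * (res z k * res z k)) mod2^ k

-- The quadratic space ⟨A,B,C⟩ ⊗ ℚ₂ is isotropic: there is a nonzero vector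
-- w with Q(w) = 0.  Since any nonzero w ∈ ℚ₂³ can be scaled by a power of 2
-- into ℤ₂³ (preserving Q(w) = 0 and w ≠ 0), it suffices to range over ℤ₂³.
IsotropicQ₂ : ℕ → ℕ → ℕ → Set
IsotropicQ₂ A B C =
  Σ ℤ₂ λ x → Σ ℤ₂ λ y → Σ ℤ₂ λ z →
    (NonZero₂ x ⊎ NonZero₂ y ⊎ NonZero₂ z) ×
    (∀ k → diagFormRes A B C x y z k ≡ 0)

-- ord₂ m ≤ C  (with ord₂ 0 = ∞):  2^(C+1) does not divide m.

ord₂≤ : ℕ → ℕ → Set
ord₂≤ m C = ¬ (2 ^ suc C ∣ m)

-- The quantities of the lemma (a, b, c ≥ 3 so a - 2 etc. are natural).

gcd3 : ℕ → ℕ → ℕ → ℕ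
gcd3 a b c = gcd (gcd a b) c

δ : ℕ → ℕ → ℕ → ℕ
δ a b c = if ⌊ 2 ∣? gcd3 a b c ⌋ then 2 else 0

Pabc : ℕ → ℕ → ℕ → ℕ
Pabc a b c = (a ∸ 2) * (b ∸ 2) * (c ∸ 2)

l : ℕ → ℕ → ℕ → ℕ → ℕ
l a b c n = 2 ^ (3 ∸ δ a b c) * Pabc a b c * n

-- the sum inside v_{a,b,c};  (a-4)^2 = ∣ a - 4 ∣^2
vNum : ℕ → ℕ → ℕ → ℕ
vNum a b c =
    (∣ a - 4 ∣ ^ 2) * (b ∸ 2) * (c ∸ 2)
  + (a ∸ 2) * (∣ b - 4 ∣ ^ 2) * (c ∸ 2)
  + (a ∸ 2) * (b ∸ 2) * (∣ c - 4 ∣ ^ 2)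

-- v = 2^{-δ} · vNum  (an integer: when δ = 2, a, b, c are all even)
v : ℕ → ℕ → ℕ → ℕ
v a b c = _/_ (vNum a b c) (2 ^ δ a b c) {{m^n≢0 2 (δ a b c)}}

-- By symmetry we may assume 4 ∤ a; then ∣a - 4∣ = 2^σ u with u odd and 4^σ ∣ a - 2.
-- Write A, B, C = a - 2, b - 2, c - 2, BC = 2^β o with o odd, and let V = 2^δ v be the
-- numerator of v.  The coefficient of n in l_n is divisible by G = 2^(3-δ) 4^σ 2^β,
-- so if G ∤ v then ord₂ (l_n + v) = ord₂ v < ord₂ G for every n.  If v = G q, then
-- S = BC ∣a - 4∣ and T = BC V satisfy S² - T = 4^(β+σ) ((u o)² - 8 o q), which is 4^(β+σ)
-- times a number ≡ 1 (mod 8) and hence, by Hensel lifting, the square of a nonzero 2-adic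
-- integer x.  Since A S² + B (AC ∣b - 4∣)² + C (AB ∣c - 4∣)² = A T, the vector
-- (x, AC ∣b - 4∣, AB ∣c - 4∣) is isotropic for ⟨A, B, C⟩.

module Submission where

open import Defs
open import Data.Nat.Base as ℕ using (ℕ; zero; suc; NonZero; ≢-nonZero⁻¹; z<s; s≤s; z≤n)
open import Data.List using ([]; _∷_)
open import Data.Product using (∃; ∃₂; _×_; _,_)
open import Data.Sum using (_⊎_; inj₁; inj₂)
open import Data.Empty using (⊥-elim)
open import Relation.Nullary using (¬_; yes; no)
open import Relation.Nullary.Decidable using (⌊_⌋)
open import Data.Bool using (if_then_else_)
open import Relation.Binary.PropositionalEquality
open ≡-Reasoning

module _ where
  open import Data.Nat using (_+_; _*_; _^_; _<_; _%_)
  open import Data.Nat.Properties using (+-suc; *-identityˡ; *-assoc; m<m+n; m^n≢0)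
  open import Data.Nat.Induction using (<-rec)
  open import Data.Nat.DivMod using (m∣n⇒o%n%m≡o%m; %-distribˡ-+; %-distribˡ-*; m%n<n; m%n%n≡m%n)
  open import Data.Nat.Divisibility using (_∣_; divides; n∣m⇒m%n≡0)

  odd : ℕ → ℕ
  odd h = 1 + 2 * h

  even-or-odd : ∀ n → (∃ λ h → n ≡ 2 * h) ⊎ (∃ λ h → n ≡ odd h)
  even-or-odd zero = inj₁ (0 , refl)
  even-or-odd (suc n) with even-or-odd n
  ... | inj₁ (h , refl) = inj₂ (h , refl)
  ... | inj₂ (h , refl) = inj₁ (suc h , cong suc (sym (+-suc h (h + 0))))

  2-adic-decomposition : ∀ n .{{_ : NonZero n}} → ∃₂ λ e h → n ≡ 2 ^ e * odd h
  2-adic-decomposition n = <-rec _ decompose n (≢-nonZero⁻¹ n)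
    where
    decompose : ∀ n → (∀ {m} → m < n → m ≢ 0 → ∃₂ λ e h → m ≡ 2 ^ e * odd h) →
                n ≢ 0 → ∃₂ λ e h → n ≡ 2 ^ e * odd h
    decompose n rec n≢0 with even-or-odd n
    ... | inj₂ (h , refl) = 0 , h , sym (*-identityˡ (odd h))
    ... | inj₁ (zero , refl) = ⊥-elim (n≢0 refl)
    ... | inj₁ (m@(suc _) , refl) with rec (m<m+n m z<s) (λ ())
    ... | e , h , m≡ = suc e , h , trans (cong (2 *_) m≡) (sym (*-assoc 2 (2 ^ e) (odd h)))

  Coherent : (ℕ → ℕ) → Set
  Coherent f = ∀ k → f (suc k) mod2^ k ≡ f k mod2^ k

  fromCoherent : (f : ℕ → ℕ) → Coherent f → ℤ₂
  fromCoherent f coh = mkℤ₂ (λ k → f k mod2^ k) (λ k → m%n<n (f k) (2 ^ k) {{m^n≢0 2 k}}) compatible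
    where
    compatible : ∀ k → (f (suc k) mod2^ suc k) mod2^ k ≡ f k mod2^ k
    compatible k = trans (m∣n⇒o%n%m≡o%m (2 ^ k) (2 ^ suc k) (f (suc k)) {{m^n≢0 2 k}} {{m^n≢0 2 (suc k)}} (divides 2 refl))
                      (coh k)

  diagForm : ℕ → ℕ → ℕ → ℕ → ℕ → ℕ → ℕ
  diagForm A B C x y z = A * (x * x) + B * (y * y) + C * (z * z)

  module _ {d} .{{_ : NonZero d}} where

    %-cong-+ : ∀ {m m′ n n′} → m % d ≡ m′ % d → n % d ≡ n′ % d → (m + n) % d ≡ (m′ + n′) % d
    %-cong-+ {m} {m′} {n} {n′} m≡ n≡ = begin
      (m + n) % d             ≡⟨ %-distribˡ-+ m n d ⟩
      (m % d + n % d) % d     ≡⟨ cong₂ (λ u w → (u + w) % d) m≡ n≡ ⟩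
      (m′ % d + n′ % d) % d   ≡⟨ %-distribˡ-+ m′ n′ d ⟨
      (m′ + n′) % d           ∎

    %-cong-* : ∀ {m m′ n n′} → m % d ≡ m′ % d → n % d ≡ n′ % d → (m * n) % d ≡ (m′ * n′) % d
    %-cong-* {m} {m′} {n} {n′} m≡ n≡ = begin
      (m * n) % d             ≡⟨ %-distribˡ-* m n d ⟩
      (m % d * (n % d)) % d   ≡⟨ cong₂ (λ u w → (u * w) % d) m≡ n≡ ⟩
      (m′ % d * (n′ % d)) % d ≡⟨ %-distribˡ-* m′ n′ d ⟨
      (m′ * n′) % d           ∎

    diagForm-%-cong : ∀ A B C x y z → diagForm A B C (x % d) (y % d) (z % d) % d ≡ diagForm A B C x y z % d
    diagForm-%-cong A B C x y z = %-cong-+ (%-cong-+ (term A x) (term B y)) (term C z)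
      where
      term : ∀ M w → (M * (w % d * (w % d))) % d ≡ (M * (w * w)) % d
      term M w = %-cong-* {M} refl (%-cong-* (m%n%n≡m%n w d) (m%n%n≡m%n w d))

  isotropic-of-approximations : ∀ {A B C} (f g h : ℕ → ℕ) → Coherent f → Coherent g → Coherent h →
    ∃ (λ k → f k mod2^ k ≢ 0) → (∀ k → 2 ^ k ∣ diagForm A B C (f k) (g k) (h k)) → IsotropicQ₂ A B C
  isotropic-of-approximations {A} {B} {C} f g h f-coh g-coh h-coh f≢0 2^k∣Q =
    fromCoherent f f-coh , fromCoherent g g-coh , fromCoherent h h-coh , inj₁ f≢0 ,
    λ k → trans (diagForm-%-cong {{m^n≢0 2 k}} A B C (f k) (g k) (h k)) (n∣m⇒m%n≡0 _ _ {{m^n≢0 2 k}} (2^k∣Q k))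

module _ where
  open import Data.Nat using (_^_)
  open import Data.Nat.Properties using (m^n≢0; ^-monoʳ-<; n<1+n)
  open import Data.Nat.DivMod using ([m+kn]%n≡m%n; m<n⇒m%n≡m)
  import Data.Nat.Divisibility as ℕ
  open import Data.Nat.Tactic.RingSolver as ℕ-Solver using ()
  open import Data.Integer using (ℤ; +_; _+_; _*_; _-_; 1ℤ; ∣_∣)
  open import Data.Integer.Properties using (pos-*)
  open import Data.Integer.DivMod using (_%ℕ_; _/ℕ_; a≡a%ℕn+[a/ℕn]*n)
  open import Data.Integer.Divisibility.Signed using (_∣_; divides; ∣n⇒∣m*n; ∣⇒∣ᵤ)
  open import Data.Integer.Tactic.RingSolver using (solve)

  record NonzeroSquare₂ (m : ℤ) : Set where
    field
      root     : ℕ → ℕ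
      coherent : Coherent root
      nonzero  : ∃ λ k → root k mod2^ k ≢ 0
      squares  : ∀ k → + (2 ^ k) ∣ + root k * + root k - m

  pos-*-square : ∀ a x → + (a ℕ.* (x ℕ.* x)) ≡ + a * (+ x * + x)
  pos-*-square a x = trans (pos-* a (x ℕ.* x)) (cong (+ a *_) (pos-* x x))

  a[x²-[s²-t]]≡ax²+p+q : ∀ a x s t p q → a * (s * s) + p + q ≡ a * t → a * (x * x - (s * s - t)) ≡ a * (x * x) + p + q
  a[x²-[s²-t]]≡ax²+p+q a x s t p q as²+p+q≡at = begin
    a * (x * x - (s * s - t))                         ≡⟨ solve (a ∷ x ∷ s ∷ t ∷ []) ⟩
    a * (x * x) + (a * t - a * (s * s))               ≡⟨ cong (λ u → a * (x * x) + (u - a * (s * s))) as²+p+q≡at ⟨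
    a * (x * x) + (a * (s * s) + p + q - a * (s * s)) ≡⟨ solve (a ∷ x ∷ s ∷ p ∷ q ∷ []) ⟩
    a * (x * x) + p + q                               ∎

  -- Q(x, y, z) = A (x² - (S² - T)) + (Q(S, y, z) - A T), so the approximate roots x of S² - T
  -- give vectors (x, y, z) on which Q vanishes to higher and higher 2-adic order.
  isotropic-of-square : ∀ {A B C y z S T} → diagForm A B C S y z ≡ A ℕ.* T →
    NonzeroSquare₂ (+ S * + S - + T) → IsotropicQ₂ A B C
  isotropic-of-square {A} {B} {C} {y} {z} {S} {T} Q[S,y,z]≡AT sq =
    isotropic-of-approximations {A} {B} {C} root (λ _ → y) (λ _ → z) coherent (λ _ → refl) (λ _ → refl) nonzero
      λ k → subst (2 ^ k ℕ.∣_) (cong ∣_∣ (Q≡ (root k))) (∣⇒∣ᵤ (∣n⇒∣m*n (+ A) (squares k)))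
    where
    open NonzeroSquare₂ sq
    p = + (B ℕ.* (y ℕ.* y))
    q = + (C ℕ.* (z ℕ.* z))
    AS²+p+q≡AT : + A * (+ S * + S) + p + q ≡ + A * + T
    AS²+p+q≡AT = begin
      + A * (+ S * + S) + p + q  ≡⟨ cong (λ u → u + p + q) (pos-*-square A S) ⟨
      + diagForm A B C S y z     ≡⟨ cong +_ Q[S,y,z]≡AT ⟩
      + (A ℕ.* T)                ≡⟨ pos-* A T ⟩
      + A * + T                  ∎
    Q≡ : ∀ x → + A * (+ x * + x - (+ S * + S - + T)) ≡ + diagForm A B C x y z
    Q≡ x = trans (a[x²-[s²-t]]≡ax²+p+q (+ A) (+ x) (+ S) (+ T) p q AS²+p+q≡AT)
                 (cong (λ u → u + p + q) (sym (pos-*-square A x)))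

  pos-odd : ∀ h → + odd h ≡ 1ℤ + + 2 * + h
  pos-odd h = cong (λ u → 1ℤ + u) (pos-* 2 h)

  lift-identity : ∀ h P e d m q →
    (1ℤ + + 2 * h) * (1ℤ + + 2 * h) - m ≡ + 8 * P * q → q ≡ e + d * + 2 →
    (1ℤ + + 2 * (h + + 2 * P * e)) * (1ℤ + + 2 * (h + + 2 * P * e)) - m ≡ + 8 * (+ 2 * P) * (d + e + e * h + P * e * e)
  lift-identity h P e d m q y²-m≡8Pq q≡e+2d = begin
    (1ℤ + + 2 * (h + + 2 * P * e)) * (1ℤ + + 2 * (h + + 2 * P * e)) - m
      ≡⟨ solve (h ∷ P ∷ e ∷ m ∷ []) ⟩
    ((1ℤ + + 2 * h) * (1ℤ + + 2 * h) - m) + + 8 * P * (e + + 2 * e * h + + 2 * P * e * e)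
      ≡⟨ cong (λ u → u + + 8 * P * (e + + 2 * e * h + + 2 * P * e * e)) y²-m≡8Pq ⟩
    + 8 * P * q + + 8 * P * (e + + 2 * e * h + + 2 * P * e * e)
      ≡⟨ cong (λ u → + 8 * P * u + + 8 * P * (e + + 2 * e * h + + 2 * P * e * e)) q≡e+2d ⟩
    + 8 * P * (e + d * + 2) + + 8 * P * (e + + 2 * e * h + + 2 * P * e * e)
      ≡⟨ solve (h ∷ P ∷ e ∷ d ∷ []) ⟩
    + 8 * (+ 2 * P) * (d + e + e * h + P * e * e) ∎

  module _ (m : ℤ) where

    record OddRoot (k : ℕ) : Set where
      constructor oddRoot
      field
        half   : ℕ
        quot   : ℤ
        approx : + odd half * + odd half - m ≡ + 8 * + (2 ^ k) * quot

    -- Adding 2^(k+2) e to the odd root y changes y² - m by 2^(k+3) (e y + 2^(k+1) e²), so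
    -- taking e ≡ quot (mod 2) makes the new quotient even.
    lift : ∀ {k} → OddRoot k → OddRoot (suc k)
    lift {k} (oddRoot h q approx) = oddRoot h′ q′ (begin
      + odd h′ * + odd h′ - m                                          ≡⟨ cong (λ y → y * y - m) (pos-odd h′) ⟩
      (1ℤ + + 2 * + h′) * (1ℤ + + 2 * + h′) - m                        ≡⟨ cong (λ u → (1ℤ + + 2 * (+ h + u)) * (1ℤ + + 2 * (+ h + u)) - m) pos-2Pe ⟩
      (1ℤ + + 2 * (+ h + + 2 * + P * + e)) * (1ℤ + + 2 * (+ h + + 2 * + P * + e)) - m
        ≡⟨ lift-identity (+ h) (+ P) (+ e) d m q (trans (cong (λ y → y * y - m) (sym (pos-odd h))) approx) (a≡a%ℕn+[a/ℕn]*n q 2) ⟩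
      + 8 * (+ 2 * + P) * q′                                           ≡⟨ cong (λ u → + 8 * u * q′) (pos-* 2 P) ⟨
      + 8 * + (2 ^ suc k) * q′                                         ∎)
      where
      P = 2 ^ k
      e = q %ℕ 2
      d = q /ℕ 2
      h′ = h ℕ.+ 2 ℕ.* P ℕ.* e
      q′ = d + + e + + e * + h + + P * + e * + e
      pos-2Pe : + (2 ℕ.* P ℕ.* e) ≡ + 2 * + P * + e
      pos-2Pe = trans (pos-* (2 ℕ.* P) e) (cong (_* + e) (pos-* 2 P))

    oddRoots : OddRoot 0 → ∀ k → OddRoot k
    oddRoots r₀ zero = r₀
    oddRoots r₀ (suc k) = lift (oddRoots r₀ k)

  oddRoot₀ : ∀ h t → OddRoot (+ odd h * + odd h - + 8 * t) 0
  oddRoot₀ h t = oddRoot h t (cancel (+ odd h * + odd h) t)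
    where
    cancel : ∀ y t → y - (y - + 8 * t) ≡ + 8 * + 1 * t
    cancel y t = solve (y ∷ t ∷ [])

  scale-square : ∀ Q y m P q → y * y - m ≡ + 8 * P * q → Q * y * (Q * y) - Q * Q * m ≡ Q * Q * + 8 * q * P
  scale-square Q y m P q y²-m≡8Pq = begin
    Q * y * (Q * y) - Q * Q * m  ≡⟨ solve (Q ∷ y ∷ m ∷ []) ⟩
    Q * Q * (y * y - m)          ≡⟨ cong (Q * Q *_) y²-m≡8Pq ⟩
    Q * Q * (+ 8 * P * q)        ≡⟨ solve (Q ∷ P ∷ q ∷ []) ⟩
    Q * Q * + 8 * q * P          ∎

  -- The roots 2^s y_k stay nonzero because each y_k is odd: 2^s y_(s+1) ≡ 2^s (mod 2^(s+1)).
  nonzeroSquare₂-4^s : ∀ s {m} → OddRoot m 0 → NonzeroSquare₂ (+ (2 ^ s) * + (2 ^ s) * m)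
  nonzeroSquare₂-4^s s {m} r₀ = record
    { root = root
    ; coherent = coherent
    ; nonzero = suc s , nonzero
    ; squares = squares
    }
    where
    open OddRoot
    Q = 2 ^ s
    h : ℕ → ℕ
    h k = half (oddRoots m r₀ k)
    root : ℕ → ℕ
    root k = Q ℕ.* odd (h k)

    coherent : Coherent root
    coherent k = trans (cong (_mod2^ k) (step Q (h k) (2 ^ k) e)) ([m+kn]%n≡m%n (root k) (Q ℕ.* 4 ℕ.* e) (2 ^ k) {{m^n≢0 2 k}})
      where
      e = quot (oddRoots m r₀ k) %ℕ 2
      step : ∀ Q h P e → Q ℕ.* (1 ℕ.+ 2 ℕ.* (h ℕ.+ 2 ℕ.* P ℕ.* e)) ≡ Q ℕ.* (1 ℕ.+ 2 ℕ.* h) ℕ.+ Q ℕ.* 4 ℕ.* e ℕ.* P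
      step = ℕ-Solver.solve-∀

    nonzero : root (suc s) mod2^ suc s ≢ 0
    nonzero root≡0 = ≢-nonZero⁻¹ Q {{m^n≢0 2 s}} (begin
      Q                                             ≡⟨ m<n⇒m%n≡m {{m^n≢0 2 (suc s)}} (^-monoʳ-< 2 (s≤s (s≤s z≤n)) (n<1+n s)) ⟨
      Q mod2^ suc s                                 ≡⟨ [m+kn]%n≡m%n Q (h (suc s)) (2 ^ suc s) {{m^n≢0 2 (suc s)}} ⟨
      (Q ℕ.+ h (suc s) ℕ.* (2 ℕ.* Q)) mod2^ suc s   ≡⟨ cong (_mod2^ suc s) (split Q (h (suc s))) ⟨
      root (suc s) mod2^ suc s                      ≡⟨ root≡0 ⟩
      0                                             ∎)
      where
      split : ∀ Q h → Q ℕ.* (1 ℕ.+ 2 ℕ.* h) ≡ Q ℕ.+ h ℕ.* (2 ℕ.* Q)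
      split = ℕ-Solver.solve-∀

    squares : ∀ k → + (2 ^ k) ∣ + root k * + root k - + Q * + Q * m
    squares k = divides (+ Q * + Q * + 8 * quot (oddRoots m r₀ k)) (begin
      + root k * + root k - + Q * + Q * m                       ≡⟨ cong (λ y → y * y - + Q * + Q * m) (pos-* Q (odd (h k))) ⟩
      + Q * + odd (h k) * (+ Q * + odd (h k)) - + Q * + Q * m    ≡⟨ scale-square (+ Q) (+ odd (h k)) m (+ (2 ^ k)) _ (approx (oddRoots m r₀ k)) ⟩
      + Q * + Q * + 8 * quot (oddRoots m r₀ k) * + (2 ^ k)      ∎)

  nonzeroSquare₂-4^s[u²-8t] : ∀ s h t {S T} → S ≡ 2 ^ s ℕ.* odd h → T ≡ 2 ^ s ℕ.* 2 ^ s ℕ.* (8 ℕ.* t) →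
    NonzeroSquare₂ (+ S * + S - + T)
  nonzeroSquare₂-4^s[u²-8t] s h t refl refl =
    subst NonzeroSquare₂ (sym S²-T≡) (nonzeroSquare₂-4^s s (oddRoot₀ h (+ t)))
    where
    Q = 2 ^ s
    S²-T≡ : + (Q ℕ.* odd h) * + (Q ℕ.* odd h) - + (Q ℕ.* Q ℕ.* (8 ℕ.* t)) ≡ + Q * + Q * (+ odd h * + odd h - + 8 * + t)
    S²-T≡ = begin
      + (Q ℕ.* odd h) * + (Q ℕ.* odd h) - + (Q ℕ.* Q ℕ.* (8 ℕ.* t))
        ≡⟨ cong₂ (λ u w → u * u - w) (pos-* Q (odd h)) (trans (pos-* (Q ℕ.* Q) (8 ℕ.* t)) (cong₂ _*_ (pos-* Q Q) (pos-* 8 t))) ⟩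
      + Q * + odd h * (+ Q * + odd h) - + Q * + Q * (+ 8 * + t)
        ≡⟨ factor (+ Q) (+ odd h) (+ t) ⟩
      + Q * + Q * (+ odd h * + odd h - + 8 * + t) ∎
      where
      factor : ∀ Q y t → Q * y * (Q * y) - Q * Q * (+ 8 * t) ≡ Q * Q * (y * y - + 8 * t)
      factor Q y t = solve (Q ∷ y ∷ t ∷ [])

open import Data.Nat using (_+_; _*_; _∸_; _^_; _≤_; ∣_-_∣)
open import Data.Nat.Properties using (*-identityˡ; *-assoc; ∣-∣-identityʳ; *-distribʳ-∣-∣; ^-distribˡ-+-*; m^n≢0)
open import Data.Nat.DivMod using (m*[n/m]≡n; /-congˡ; /-congʳ)
open import Data.Nat.Divisibility using (_∣_; _∣?_; divides; 1∣_; ∣-refl; ∣-trans; n∣m*n; ∣m+n∣m⇒∣n; ∣m∣n⇒∣m+n; ∣m⇒∣m*n; ∣n⇒∣m*n; *-pres-∣)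
open import Data.Nat.GCD using (gcd; gcd-comm; gcd-assoc; gcd[m,n]∣m; gcd[m,n]∣n)
open import Data.Nat.Tactic.RingSolver using (solve-∀)

∣m∣n⇒∣∣m-n∣ : ∀ {d m n} → d ∣ m → d ∣ n → d ∣ ∣ m - n ∣
∣m∣n⇒∣∣m-n∣ {d} (divides p refl) (divides q refl) = divides ∣ p - q ∣ (sym (*-distribʳ-∣-∣ d p q))

∣a-4∣-valuation : ∀ a → 3 ≤ a → ¬ 4 ∣ a →
  ∃₂ λ σ h → ∣ a - 4 ∣ ≡ 2 ^ σ * odd h × 2 ^ σ * 2 ^ σ ∣ a ∸ 2
∣a-4∣-valuation a 3≤a 4∤a with even-or-odd a
∣a-4∣-valuation _ (s≤s ()) _ | inj₂ (0 , refl)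
... | inj₂ (1 , refl) = 0 , 0 , refl , 1∣ _
... | inj₂ (suc (suc h) , refl) = 0 , h , trans (cong (∣_- 4 ∣) (odd[2+h] h)) (trans (∣-∣-identityʳ (odd h)) (sym (*-identityˡ (odd h)))) , 1∣ _
  where
  odd[2+h] : ∀ h → 1 + 2 * (2 + h) ≡ 4 + (1 + 2 * h)
  odd[2+h] = solve-∀
... | inj₁ (m , refl) with even-or-odd m
...   | inj₁ (j , refl) = ⊥-elim (4∤a (divides j (4j j)))
  where
  4j : ∀ j → 2 * (2 * j) ≡ j * 4
  4j = solve-∀
∣a-4∣-valuation _ (s≤s (s≤s ())) _ | inj₁ (_ , refl) | inj₂ (0 , refl)
...   | inj₂ (suc j , refl) =
  1 , j , trans (cong (∣_- 4 ∣) (4+2odd j)) (∣-∣-identityʳ (2 * odd j)) , divides (suc j) (cong (_∸ 2) (2+4[1+j] j))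
  where
  4+2odd : ∀ j → 2 * (1 + 2 * suc j) ≡ 4 + 2 * (1 + 2 * j)
  4+2odd = solve-∀
  2+4[1+j] : ∀ j → 2 * (1 + 2 * suc j) ≡ 2 + suc j * 4
  2+4[1+j] = solve-∀

-- vNum a b c is, by definition, vForm (a ∸ 2) (b ∸ 2) (c ∸ 2) ∣ a - 4 ∣ ∣ b - 4 ∣ ∣ c - 4 ∣.
vForm : ℕ → ℕ → ℕ → ℕ → ℕ → ℕ → ℕ
vForm A B C Da Db Dc = Da ^ 2 * B * C + A * Db ^ 2 * C + A * B * Dc ^ 2

4∣vForm : ∀ A B C {Da Db Dc} → 2 ∣ Da → 2 ∣ Db → 2 ∣ Dc → 4 ∣ vForm A B C Da Db Dc
4∣vForm A B C 2∣Da 2∣Db 2∣Dc =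
  ∣m∣n⇒∣m+n (∣m∣n⇒∣m+n (∣m⇒∣m*n C (∣m⇒∣m*n B (4∣² 2∣Da))) (∣m⇒∣m*n C (∣n⇒∣m*n A (4∣² 2∣Db))))
            (∣n⇒∣m*n (A * B) (4∣² 2∣Dc))
  where
  4∣² : ∀ {x} → 2 ∣ x → 4 ∣ x ^ 2
  4∣² 2∣x = *-pres-∣ 2∣x (∣m⇒∣m*n 1 2∣x)

diagForm-vForm : ∀ A B C Da Db Dc →
  diagForm A B C (B * C * Da) (A * C * Db) (A * B * Dc) ≡ A * (B * C * vForm A B C Da Db Dc)
diagForm-vForm = expand
  where
  expand : ∀ A B C Da Db Dc →
    A * (B * C * Da * (B * C * Da)) + B * (A * C * Db * (A * C * Db)) + C * (A * B * Dc * (A * B * Dc))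
    ≡ A * (B * C * (Da * (Da * 1) * B * C + A * (Db * (Db * 1)) * C + A * B * (Dc * (Dc * 1))))
  expand = solve-∀

2^-split : ∀ e σ β → 2 ^ (e + (σ + σ + β)) ≡ 2 ^ e * (2 ^ σ * 2 ^ σ * 2 ^ β)
2^-split e σ β = begin
  2 ^ (e + (σ + σ + β))            ≡⟨ ^-distribˡ-+-* 2 e (σ + σ + β) ⟩
  2 ^ e * 2 ^ (σ + σ + β)          ≡⟨ cong (2 ^ e *_) (^-distribˡ-+-* 2 (σ + σ) β) ⟩
  2 ^ e * (2 ^ (σ + σ) * 2 ^ β)    ≡⟨ cong (λ u → 2 ^ e * (u * 2 ^ β)) (^-distribˡ-+-* 2 σ σ) ⟩
  2 ^ e * (2 ^ σ * 2 ^ σ * 2 ^ β)  ∎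

ord₂≤-affine : ∀ g {m w} → 2 ^ g ∣ m → ¬ 2 ^ g ∣ w → ∀ n → ord₂≤ (m * n + w) g
ord₂≤-affine g 2^g∣m 2^g∤w n 2^[1+g]∣mn+w =
  2^g∤w (∣m+n∣m⇒∣n (∣-trans (n∣m*n 2) 2^[1+g]∣mn+w) (∣m⇒∣m*n n 2^g∣m))

module _ (A B C Da Db Dc d e w : ℕ) (8≡ : 2 ^ d * 2 ^ e ≡ 8) (V≡ : vForm A B C Da Db Dc ≡ 2 ^ d * w) where

  isotropic-of-divisible : ∀ σ h β o q → w ≡ q * 2 ^ (e + (σ + σ + β)) →
    Da ≡ 2 ^ σ * odd h → B * C ≡ 2 ^ β * odd o → IsotropicQ₂ A B C
  isotropic-of-divisible σ h β o q w≡ Da≡ BC≡ =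
    isotropic-of-square {A} {B} {C} {A * C * Db} {A * B * Dc} {S} {T} (diagForm-vForm A B C Da Db Dc)
      (nonzeroSquare₂-4^s[u²-8t] (β + σ) (o + h + 2 * o * h) (odd o * q) S≡ T≡)
    where
    S = B * C * Da
    T = B * C * vForm A B C Da Db Dc
    S≡ : S ≡ 2 ^ (β + σ) * odd (o + h + 2 * o * h)
    S≡ = begin
      B * C * Da                               ≡⟨ cong₂ _*_ BC≡ Da≡ ⟩
      2 ^ β * odd o * (2 ^ σ * odd h)          ≡⟨ regroup (2 ^ β) (2 ^ σ) o h ⟩
      2 ^ β * 2 ^ σ * odd (o + h + 2 * o * h)  ≡⟨ cong (_* odd (o + h + 2 * o * h)) (^-distribˡ-+-* 2 β σ) ⟨
      2 ^ (β + σ) * odd (o + h + 2 * o * h)    ∎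
      where
      regroup : ∀ P Q o h → P * (1 + 2 * o) * (Q * (1 + 2 * h)) ≡ P * Q * (1 + 2 * (o + h + 2 * o * h))
      regroup = solve-∀
    T≡ : T ≡ 2 ^ (β + σ) * 2 ^ (β + σ) * (8 * (odd o * q))
    T≡ = begin
      B * C * vForm A B C Da Db Dc
        ≡⟨ cong₂ _*_ BC≡ (trans V≡ (cong (2 ^ d *_) (trans w≡ (cong (q *_) (2^-split e σ β))))) ⟩
      2 ^ β * odd o * (2 ^ d * (q * (2 ^ e * (2 ^ σ * 2 ^ σ * 2 ^ β))))
        ≡⟨ regroup (2 ^ β) (2 ^ σ) (2 ^ d) (2 ^ e) o q ⟩
      2 ^ β * 2 ^ σ * (2 ^ β * 2 ^ σ) * (2 ^ d * 2 ^ e * (odd o * q))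
        ≡⟨ cong₂ (λ u v → u * u * (v * (odd o * q))) (sym (^-distribˡ-+-* 2 β σ)) 8≡ ⟩
      2 ^ (β + σ) * 2 ^ (β + σ) * (8 * (odd o * q)) ∎
      where
      regroup : ∀ Pβ Pσ Pd Pe o q → Pβ * (1 + 2 * o) * (Pd * (q * (Pe * (Pσ * Pσ * Pβ))))
                                  ≡ Pβ * Pσ * (Pβ * Pσ) * (Pd * Pe * ((1 + 2 * o) * q))
      regroup = solve-∀

  isotropic-or-bounded : (∃₂ λ σ h → Da ≡ 2 ^ σ * odd h × 2 ^ σ * 2 ^ σ ∣ A) → (∃₂ λ β o → B * C ≡ 2 ^ β * odd o) →
    IsotropicQ₂ A B C ⊎ ∃ λ K → ∀ n → ord₂≤ (2 ^ e * (A * B * C) * n + w) K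
  isotropic-or-bounded (σ , h , Da≡ , 4^σ∣A) (β , o , BC≡) with 2 ^ (e + (σ + σ + β)) ∣? w
  ... | yes (divides q w≡) = inj₁ (isotropic-of-divisible σ h β o q w≡ Da≡ BC≡)
  ... | no 2^g∤w = inj₂ (e + (σ + σ + β) , ord₂≤-affine (e + (σ + σ + β)) 2^g∣l 2^g∤w)
    where
    2^g∣l : 2 ^ (e + (σ + σ + β)) ∣ 2 ^ e * (A * B * C)
    2^g∣l = subst₂ _∣_ (sym (2^-split e σ β)) (cong (2 ^ e *_) (trans (cong (A *_) (sym BC≡)) (sym (*-assoc A B C))))
                   (*-pres-∣ (∣-refl {2 ^ e}) (*-pres-∣ 4^σ∣A (∣m⇒∣m*n (odd o) ∣-refl)))

δ-cases : ∀ a b c → δ a b c ≡ 0 ⊎ δ a b c ≡ 2 × 2 ∣ gcd3 a b c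
δ-cases a b c with 2 ∣? gcd3 a b c
... | yes 2∣g = inj₂ (refl , 2∣g)
... | no _ = inj₁ refl

2^δ*2^[3∸δ]≡8 : ∀ a b c → 2 ^ δ a b c * 2 ^ (3 ∸ δ a b c) ≡ 8
2^δ*2^[3∸δ]≡8 a b c with δ-cases a b c
... | inj₁ δ≡0 rewrite δ≡0 = refl
... | inj₂ (δ≡2 , _) rewrite δ≡2 = refl

2^δ∣vNum : ∀ a b c → 2 ^ δ a b c ∣ vNum a b c
2^δ∣vNum a b c with δ-cases a b c
... | inj₁ δ≡0 rewrite δ≡0 = 1∣ _
... | inj₂ (δ≡2 , 2∣g) rewrite δ≡2 = 4∣vForm (a ∸ 2) (b ∸ 2) (c ∸ 2) (2∣∣x-4∣ 2∣a) (2∣∣x-4∣ 2∣b) (2∣∣x-4∣ 2∣c)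
  where
  2∣gcd[a,b] = ∣-trans 2∣g (gcd[m,n]∣m (gcd a b) c)
  2∣a = ∣-trans 2∣gcd[a,b] (gcd[m,n]∣m a b)
  2∣b = ∣-trans 2∣gcd[a,b] (gcd[m,n]∣n a b)
  2∣c = ∣-trans 2∣g (gcd[m,n]∣n (gcd a b) c)
  2∣∣x-4∣ : ∀ {x} → 2 ∣ x → 2 ∣ ∣ x - 4 ∣
  2∣∣x-4∣ 2∣x = ∣m∣n⇒∣∣m-n∣ 2∣x (divides 2 refl)

vNum≡2^δ*v : ∀ a b c → vNum a b c ≡ 2 ^ δ a b c * v a b c
vNum≡2^δ*v a b c = sym (m*[n/m]≡n {{m^n≢0 2 (δ a b c)}} (2^δ∣vNum a b c))

IsotropicOrBounded : ℕ → ℕ → ℕ → Set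
IsotropicOrBounded a b c =
  IsotropicQ₂ (a ∸ 2) (b ∸ 2) (c ∸ 2) ⊎ ∃ (λ C → ∀ (n : ℕ) → ord₂≤ (l a b c n + v a b c) C)

-- Matching on 3 ≤ b and 3 ≤ c exposes b ∸ 2 and c ∸ 2 as successors, so that instance search
-- finds NonZero ((b ∸ 2) * (c ∸ 2)).
isotropicOrBounded-4∤a : ∀ {a b c} → 3 ≤ a → 3 ≤ b → 3 ≤ c → ¬ 4 ∣ a → IsotropicOrBounded a b c
isotropicOrBounded-4∤a {a} {b} {c} 3≤a (s≤s (s≤s (s≤s _))) (s≤s (s≤s (s≤s _))) 4∤a =
  isotropic-or-bounded (a ∸ 2) (b ∸ 2) (c ∸ 2) ∣ a - 4 ∣ ∣ b - 4 ∣ ∣ c - 4 ∣ (δ a b c) (3 ∸ δ a b c) (v a b c)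
    (2^δ*2^[3∸δ]≡8 a b c) (vNum≡2^δ*v a b c) (∣a-4∣-valuation a 3≤a 4∤a) (2-adic-decomposition ((b ∸ 2) * (c ∸ 2)))

isotropicQ₂-rotate : ∀ {A B C} → IsotropicQ₂ B C A → IsotropicQ₂ A B C
isotropicQ₂-rotate {A} {B} {C} (x , y , z , x|y|z≢0 , Q≡0) =
  z , x , y , rotate x|y|z≢0 , λ k → trans (cong (_mod2^ k) (diagForm-rotate (res z k) (res x k) (res y k))) (Q≡0 k)
  where
  rotate : ∀ {P Q R : Set} → P ⊎ Q ⊎ R → R ⊎ P ⊎ Q
  rotate (inj₁ p) = inj₂ (inj₁ p)
  rotate (inj₂ (inj₁ q)) = inj₂ (inj₂ q)
  rotate (inj₂ (inj₂ r)) = inj₁ r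
  diagForm-rotate : ∀ z x y → diagForm A B C z x y ≡ diagForm B C A x y z
  diagForm-rotate z x y = rotate-sum A B C z x y
    where
    rotate-sum : ∀ A B C z x y → A * (z * z) + B * (x * x) + C * (y * y) ≡ B * (x * x) + C * (y * y) + A * (z * z)
    rotate-sum = solve-∀

gcd3-rotate : ∀ a b c → gcd3 b c a ≡ gcd3 a b c
gcd3-rotate a b c = trans (gcd-comm (gcd b c) a) (sym (gcd-assoc a b c))

δ-rotate : ∀ a b c → δ b c a ≡ δ a b c
δ-rotate a b c = cong (λ g → if ⌊ 2 ∣? g ⌋ then 2 else 0) (gcd3-rotate a b c)

l-rotate : ∀ a b c n → l b c a n ≡ l a b c n
l-rotate a b c n = cong₂ (λ d P → 2 ^ (3 ∸ d) * P * n) (δ-rotate a b c) (rotate-product (a ∸ 2) (b ∸ 2) (c ∸ 2))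
  where
  rotate-product : ∀ A B C → B * C * A ≡ A * B * C
  rotate-product = solve-∀

v-rotate : ∀ a b c → v b c a ≡ v a b c
v-rotate a b c = trans (/-congˡ {{m^n≢0 2 (δ b c a)}} (rotate-vForm (a ∸ 2) (b ∸ 2) (c ∸ 2) ∣ a - 4 ∣ ∣ b - 4 ∣ ∣ c - 4 ∣))
                       (/-congʳ {{m^n≢0 2 (δ b c a)}} {{m^n≢0 2 (δ a b c)}} (cong (2 ^_) (δ-rotate a b c)))
  where
  rotate-vForm : ∀ A B C Da Db Dc → vForm B C A Db Dc Da ≡ vForm A B C Da Db Dc
  rotate-vForm A B C Da Db Dc = rotate-sum A B C Da Db Dc
    where
    rotate-sum : ∀ A B C Da Db Dc →
      Db * (Db * 1) * C * A + B * (Dc * (Dc * 1)) * A + B * C * (Da * (Da * 1))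
      ≡ Da * (Da * 1) * B * C + A * (Db * (Db * 1)) * C + A * B * (Dc * (Dc * 1))
    rotate-sum = solve-∀

isotropicOrBounded-rotate : ∀ a b c → IsotropicOrBounded b c a → IsotropicOrBounded a b c
isotropicOrBounded-rotate a b c (inj₁ iso) = inj₁ (isotropicQ₂-rotate {a ∸ 2} {b ∸ 2} {c ∸ 2} iso)
isotropicOrBounded-rotate a b c (inj₂ (K , bounded)) =
  inj₂ (K , λ n → subst (λ m → ord₂≤ m K) (cong₂ _+_ (l-rotate a b c n) (v-rotate a b c)) (bounded n))

lemma2p4 : (a b c : ℕ) → 3 ≤ a → 3 ≤ b → 3 ≤ c →
           ¬ (4 ∣ a × 4 ∣ b × 4 ∣ c) →
           IsotropicQ₂ (a ∸ 2) (b ∸ 2) (c ∸ 2)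
           ⊎ ∃ (λ C → ∀ (n : ℕ) → ord₂≤ (l a b c n + v a b c) C)
lemma2p4 a b c 3≤a 3≤b 3≤c ¬4∣abc with 4 ∣? a | 4 ∣? b | 4 ∣? c
... | no 4∤a | _ | _ = isotropicOrBounded-4∤a 3≤a 3≤b 3≤c 4∤a
... | yes _ | no 4∤b | _ = isotropicOrBounded-rotate a b c (isotropicOrBounded-4∤a 3≤b 3≤c 3≤a 4∤b)
... | yes _ | yes _ | no 4∤c =
  isotropicOrBounded-rotate a b c (isotropicOrBounded-rotate b c a (isotropicOrBounded-4∤a 3≤c 3≤a 3≤b 4∤c))
... | yes 4∣a | yes 4∣b | yes 4∣c = ⊥-elim (¬4∣abc (4∣a , 4∣b , 4∣c))
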